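{- Let $G$ be a finite simple graph and $E_0\subseteq E(G)$. Then $\mathcal{M}(E_0)=\{m_e: e\in E_0\}$ is an isolating set of $\mathrm{Mid}(G)$ if and only if $V(G)\setminus V(E_0)$ is an independent set of $G$, where $V(E_0)$ is the set of endpoints of edges in $E_0$.
   Context: For a graph $H$ and $S\subseteq V(H)$, let $N_H[S]$ be $S$ together with all vertices adjacent to a vertex of $S$. A set $S\subseteq V(H)$ is an isolating set of $H$ if $V(H)\setminus N_H[S]$ is an independent set of $H$. The middle graph $\mathrm{Mid}(G)$ has vertex set $V(G)\cup\{m_e: e\in E(G)\}$, with $v\sim m_e$ iff $v$ is an endpoint of $e$, $m_e\sim m_f$ iff distinct edges $e,f$ share an endpoint, and no edges between vertices of $V(G)$. -}

module Defs where

open import Data.Nat using (ℕ)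
open import Data.Fin using (Fin; _<_)
open import Data.Bool using (Bool; true; false)
open import Data.Product using (Σ; ∃; ∃-syntax; _×_; _,_; proj₁; proj₂)
open import Data.Sum using (_⊎_; inj₁; inj₂)
open import Data.Empty using (⊥)
open import Relation.Nullary using (¬_)
open import Relation.Binary.PropositionalEquality using (_≡_; _≢_)

record Graph : Set₁ where
  field
    V   : Set
    _~_ : V → V → Set

record SimpleGraph (n : ℕ) : Set where
  field
    adj   : Fin n → Fin n → Bool
    sym   : ∀ u v → adj u v ≡ adj v u
    irrefl : ∀ u → adj u u ≡ false

module _ {n : ℕ} (G : SimpleGraph n) where
  open SimpleGraph G

  graphOf : Graph
  graphOf = record { V = Fin n ; _~_ = λ u v → adj u v ≡ true }

  -- An edge {u,v} of G, stored canonically with u < v.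
  Edge : Set
  Edge = Σ (Fin n) λ u → Σ (Fin n) λ v → (u < v) × (adj u v ≡ true)

  Endpoint : Fin n → Edge → Set
  Endpoint w (u , v , _) = (w ≡ u) ⊎ (w ≡ v)

  VE : (Edge → Set) → Fin n → Set
  VE E₀ w = ∃[ e ] (E₀ e × Endpoint w e)

  -- Middle graph adjacency on V(G) ⊎ E(G)  (inj₂ e stands for m_e)
  MidAdj : Fin n ⊎ Edge → Fin n ⊎ Edge → Set
  MidAdj (inj₁ _) (inj₁ _) = ⊥
  MidAdj (inj₁ v) (inj₂ e) = Endpoint v e
  MidAdj (inj₂ e) (inj₁ v) = Endpoint v e
  MidAdj (inj₂ e) (inj₂ f) = (e ≢ f) × ∃[ w ] (Endpoint w e × Endpoint w f)

  Mid : Graph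
  Mid = record { V = Fin n ⊎ Edge ; _~_ = MidAdj }

  Mset : (Edge → Set) → Fin n ⊎ Edge → Set
  Mset E₀ (inj₁ _) = ⊥
  Mset E₀ (inj₂ e) = E₀ e

module _ (H : Graph) where
  open Graph H

  N[_] : (V → Set) → V → Set
  N[ S ] x = S x ⊎ ∃[ y ] (S y × (y ~ x))

  Independent : (V → Set) → Set
  Independent T = ∀ x y → T x → T y → ¬ (x ~ y)

  Isolating : (V → Set) → Set
  Isolating S = Independent (λ x → ¬ N[ S ] x)

-- A vertex of Mid G lies outside N[𝓜(E₀)] exactly when it is a vertex v ∉ V(E₀),
-- or a middle vertex m_e with e ∉ E₀ meeting no edge of E₀, i.e. with both endpoints
-- outside V(E₀). If V(G) ∖ V(E₀) is independent, no such m_e exists, and the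
-- leftovers are vertices of G, which are pairwise non-adjacent in Mid G. Conversely
-- an edge uv of G with u, v ∉ V(E₀) gives the leftover edge u ~ m_uv of Mid G.
module Submission where

open import Defs
open import Data.Nat using (ℕ)
open import Data.Fin using (Fin)
open import Data.Fin.Properties using (<-cmp)
open import Data.Bool using (true; false)
open import Data.Product using (Σ; ∃-syntax; _×_; _,_)
open import Data.Sum using (_⊎_; inj₁; inj₂)
open import Data.Empty using (⊥; ⊥-elim)
open import Function.Bundles using (_⇔_; mk⇔)
open import Relation.Binary using (tri<; tri≈; tri>)
open import Relation.Binary.PropositionalEquality using (_≡_; refl; sym; trans)
open import Relation.Nullary using (¬_)

module _ {n : ℕ} (G : SimpleGraph n) where
  open SimpleGraph G renaming (sym to adj-sym)

  edge-between : ∀ u v → adj u v ≡ true →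
    Σ (Edge G) λ e → Endpoint G u e × Endpoint G v e ×
                     (∀ w → Endpoint G w e → w ≡ u ⊎ w ≡ v)
  edge-between u v uv with <-cmp u v
  ... | tri< u<v _ _ = (u , v , u<v , uv) , inj₁ refl , inj₂ refl , λ _ w∈e → w∈e
  ... | tri≈ _ refl _ with () ← trans (sym uv) (irrefl u)
  ... | tri> _ _ v<u = (v , u , v<u , trans (adj-sym v u) uv) , inj₂ refl , inj₁ refl ,
                       λ { _ (inj₁ w≡v) → inj₂ w≡v ; _ (inj₂ w≡u) → inj₁ w≡u }

  module _ (E₀ : Edge G → Set) where

    Uncovered : Fin n → Set
    Uncovered v = ¬ VE G E₀ v

    Dominated : Fin n ⊎ Edge G → Set
    Dominated = N[_] (Mid G) (Mset G E₀)

    dominated-vertex⇒covered : ∀ v → Dominated (inj₁ v) → VE G E₀ v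
    dominated-vertex⇒covered v (inj₂ (inj₂ f , f∈E₀ , v∈f)) = f , f∈E₀ , v∈f

    dominated-middle⇒endpoint-covered : ∀ e → Dominated (inj₂ e) →
      ∃[ w ] (Endpoint G w e × VE G E₀ w)
    dominated-middle⇒endpoint-covered e@(u , _) (inj₁ e∈E₀) = u , inj₁ refl , e , e∈E₀ , inj₁ refl
    dominated-middle⇒endpoint-covered e (inj₂ (inj₂ f , f∈E₀ , _ , w , w∈f , w∈e)) =
      w , w∈e , f , f∈E₀ , w∈f

    -- An edge f ∈ E₀ through an endpoint of e dominates m_e: as m_e itself if f = e,
    -- as a neighbour otherwise; refuting both cases avoids deciding f ≡ e.
    undominated-middle⇒endpoints-uncovered : ∀ e → ¬ Dominated (inj₂ e) →
      ∀ w → Endpoint G w e → Uncovered w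
    undominated-middle⇒endpoints-uncovered e free w w∈e (f , f∈E₀ , w∈f) =
      free (inj₂ (inj₂ f , f∈E₀ , f≢e , w , w∈f , w∈e))
      where
      f≢e : f ≡ e → ⊥
      f≢e refl = free (inj₁ f∈E₀)

    isolating⇒uncovered-independent :
      Isolating (Mid G) (Mset G E₀) → Independent (graphOf G) Uncovered
    isolating⇒uncovered-independent iso u v u-free v-free uv
      with e , u∈e , _ , endpoints ← edge-between u v uv
      = iso (inj₁ u) (inj₂ e) (λ d → u-free (dominated-vertex⇒covered u d)) e-free u∈e
      where
      e-free : ¬ Dominated (inj₂ e)
      e-free d with dominated-middle⇒endpoint-covered e d
      ... | w , w∈e , w-covered with endpoints w w∈e
      ...   | inj₁ refl = u-free w-covered
      ...   | inj₂ refl = v-free w-covered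

    middle-dominated : Independent (graphOf G) Uncovered →
      ∀ e → ¬ ¬ Dominated (inj₂ e)
    middle-dominated ind e@(u , v , _ , uv) free =
      ind u v (uncovered u (inj₁ refl)) (uncovered v (inj₂ refl)) uv
      where
      uncovered = undominated-middle⇒endpoints-uncovered e free

    uncovered-independent⇒isolating :
      Independent (graphOf G) Uncovered → Isolating (Mid G) (Mset G E₀)
    uncovered-independent⇒isolating ind (inj₁ _) (inj₁ _) _ _ ()
    uncovered-independent⇒isolating ind (inj₁ _) (inj₂ e) _ free _ =
      ⊥-elim (middle-dominated ind e free)
    uncovered-independent⇒isolating ind (inj₂ e) _ free _ _ =
      ⊥-elim (middle-dominated ind e free)

lemma2 : (n : ℕ) (G : SimpleGraph n) (E₀ : Edge G → Set) →
    Isolating (Mid G) (Mset G E₀) ⇔ Independent (graphOf G) (λ v → ¬ VE G E₀ v)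
lemma2 n G E₀ =
  mk⇔ (isolating⇒uncovered-independent G E₀) (uncovered-independent⇒isolating G E₀)
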